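{- For all positive integers $d$ and $m$, \[ E_{d^m} = (-1)^d \det\big(H_{(1-i+j)^m}\big)_{1 \le i, j \le d} \qquad\text{and}\qquad H_{d^m} = (-1)^d \det\big(E_{(1-i+j)^m}\big)_{1 \le i, j \le d}. \]
   Context: $\mathsf{P\Lambda}$ denotes the $\mathbb{Q}$-algebra of polysymmetric functions: formal power series of bounded degree in variables $x_{i,j}$ ($i,j\ge 1$), where $x_{i,j}$ has degree $i$, that are invariant under every permutation of the variables $x_{i,1},x_{i,2},\dots$ for each fixed $i$. A stack is a pair of positive integers written $d^m$ (degree $d$, multiplicity $m$); a stack partition $\tau\Vdash n$ is a finite weakly decreasing sequence of stacks $(d_1^{m_1},\dots,d_s^{m_s})$ (with $d^m\ge d'^{m'}$ iff $d>d'$, or $d=d'$ and $m\ge m'$) such that $\sum_i d_i m_i=n$; an ordinary partition $\alpha\vdash n$ is a stack partition with all multiplicities $1$. For $\tau=(d_1^{m_1},\dots,d_s^{m_s})$, the monomial polysymmetric function is $M_\tau=\sum_\alpha x_{d_1,\alpha_1}^{m_1}\cdots x_{d_s,\alpha_s}^{m_s}$, summed over sequences $\alpha$ of positive integers with $\alpha_i\ne\alpha_j$ whenever $d_i=d_j$, $i\neq j$. Define $H_d=\sum_{\alpha\Vdash d}M_\alpha$ and $E_d=\sum_{\alpha\vdash d}(-1)^{\ell(\alpha)}M_\alpha$, where $\ell$ is the number of parts, so that $\sum_{d\ge0}H_dt^d=\prod_{i,j}(1-x_{i,j}t^i)^{ -1}$ and $\sum_{d\ge0}E_dt^d=\prod_{i,j}(1-x_{i,j}t^i)$.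 Here $H_0=E_0=1$, and $H_k=E_k=0$ for $k<0$. For $F\in\{H,E\}$, $F_{d^m}$ denotes $F_d$ with every variable $x_{i,j}$ replaced by $x_{i,j}^m$ (so in particular $F_{0^m}=1$ and $F_{k^m}=0$ for $k<0$). -}

module Defs where

open import Data.Nat as ℕ using (ℕ; zero; suc; _≤?_; _∸_)
open import Data.Integer as ℤ using (ℤ; +_; -[1+_])
open import Data.Rational using (ℚ; 0ℚ; 1ℚ; _+_; _*_; -_; _-_)
open import Data.Fin using (Fin; zero; suc; toℕ; punchIn)
open import Data.List using (List; []; _∷_; _++_; map; concatMap; allFin)
open import Data.Product using (_×_; _,_)
open import Relation.Nullary using (yes; no)

_^ℚ_ : ℚ → ℕ → ℚ
q ^ℚ zero = 1ℚ
q ^ℚ suc n = q * (q ^ℚ n)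

sgn : ℕ → ℚ
sgn zero = 1ℚ
sgn (suc n) = - sgn n

-- A finite list of variables, each given as (weight i , value of x_{i,j}).
Vars : Set
Vars = List (ℕ × ℚ)

-- Evaluation of H_d at a finite list of weighted variables, via the
-- generating function  Σ H_d t^d = Π (1 - x t^w)^{-1} :
-- the contribution of a variable (w , v) is Σ_k v^k t^{w k}.
Hsum : ℚ → ℕ → (ℕ → ℚ) → ℕ → ℕ → ℚ
Hsum v w h d zero = h d
Hsum v w h d (suc k) with w ℕ.* suc k ≤? d
... | yes _ = Hsum v w h d k + (v ^ℚ suc k) * h (d ∸ w ℕ.* suc k)
... | no _ = Hsum v w h d k

Hev : Vars → ℕ → ℚ
Hev [] zero = 1ℚ
Hev [] (suc _) = 0ℚ
Hev ((w , v) ∷ vs) d = Hsum v w (Hev vs) d d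

-- Evaluation of E_d via  Σ E_d t^d = Π (1 - x t^w).
Eev : Vars → ℕ → ℚ
Eev [] zero = 1ℚ
Eev [] (suc _) = 0ℚ
Eev ((w , v) ∷ vs) d with w ≤? d
... | yes _ = Eev vs d - v * Eev vs (d ∸ w)
... | no _ = Eev vs d

-- A finite truncation of the variables: x i j is the value of
-- x_{i+1, j+1} (for i < K, j < N); all other variables are set to 0.
-- Replacing every variable by its m-th power (for F_{d^m}).
vars : (K N m : ℕ) → (Fin K → Fin N → ℚ) → Vars
vars K N m x =
  concatMap (λ i → map (λ j → (suc (toℕ i) , x i j ^ℚ m)) (allFin N)) (allFin K)

-- F_{k^m} evaluated at x, for an integer k (0 for k < 0, 1 for k = 0).
HZ : (K N m : ℕ) → (Fin K → Fin N → ℚ) → ℤ → ℚ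
HZ K N m x (+ k) = Hev (vars K N m x) k
HZ K N m x -[1+ _ ] = 0ℚ

EZ : (K N m : ℕ) → (Fin K → Fin N → ℚ) → ℤ → ℚ
EZ K N m x (+ k) = Eev (vars K N m x) k
EZ K N m x -[1+ _ ] = 0ℚ

sumFin : (n : ℕ) → (Fin n → ℚ) → ℚ
sumFin zero f = 0ℚ
sumFin (suc n) f = f zero + sumFin n (λ j → f (suc j))

det : (n : ℕ) → (Fin n → Fin n → ℚ) → ℚ
det zero A = 1ℚ
det (suc n) A =
  sumFin (suc n) (λ j → sgn (toℕ j) * (A zero j * det n (λ r c → A (suc r) (punchIn j c))))

-- the integer 1 - i + j for 0-based indices (same as for 1-based ones)
idx : {d : ℕ} → Fin d → Fin d → ℤ
idx i j = (+ 1 ℤ.- + toℕ i) ℤ.+ + toℕ j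

{-# OPTIONS --safe #-}
-- Write E(t) = Σ E_d t^d and H(t) = Σ H_d t^d for the m-th powers of finitely
-- many variables. Then E(t) H(t) = 1: adjoining a variable v of weight w
-- multiplies E(t) by 1 − v tʷ and H(t) by its inverse. For any series F with
-- F_0 = 1 and inverse series b, expanding the Hessenberg–Toeplitz determinant
-- D_n = det (F_{1−i+j}) along its first row gives
-- D_{n+1} = Σ_j (−1)^j F_{j+1} D_{n−j}, and (−1)^n b_n satisfies the same
-- recurrence because Σ_k F_k b_{n+1−k} = 0. Take (F , b) = (H , E) and (E , H).
module Submission where

open import Defs
open import Data.Nat using (ℕ; _≤_)
open import Data.Fin using (Fin)
open import Data.Rational using (ℚ; _*_)
open import Data.Product using (_×_)
open import Relation.Binary.PropositionalEquality using (_≡_)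

open import Algebra.Bundles using (CommutativeRing)
open import Data.Fin using (zero; suc; toℕ; punchIn; opposite)
import Data.Fin.Permutation as Perm
import Data.Fin.Properties as Finₚ
open import Data.Integer as ℤ using (ℤ; -[1+_])
open import Data.Integer.Tactic.RingSolver using (solve-∀)
open import Data.List using ([]; _∷_; allFin)
open import Data.List.Relation.Unary.All using (All; []; _∷_; universal)
import Data.List.Relation.Unary.All.Properties as Allₚ
open import Data.Nat as ℕ using (zero; suc; _<_; _≤?_; _∸_; _≤′_; ≤′-refl; ≤′-step; z≤n; s≤s)
open import Data.Nat.Induction using (<-rec)
import Data.Nat.Properties as ℕₚ
open import Data.Product using (_,_; proj₁)
open import Data.Rational using (0ℚ; 1ℚ; _+_; -_; _-_)
import Data.Rational.Properties as ℚₚ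
open import Data.Rational.Solver using (module +-*-Solver)
open import Function using (_∘_)
open import Relation.Binary.PropositionalEquality
  using (refl; sym; trans; cong; cong₂; subst; _≗_; module ≡-Reasoning)
open import Relation.Nullary using (yes; no; ¬_)
open import Relation.Nullary.Negation using (contradiction)

open import Algebra.Properties.Semiring.Sum (CommutativeRing.semiring ℚₚ.+-*-commutativeRing)
  using (sum; sum-cong-≗; sum-permute; sum-replicate-zero; ∑-distrib-+; *-distribˡ-sum)
open import Algebra.Properties.Group ℚₚ.+-0-group using (inverseʳ-unique)
open +-*-Solver
open ≡-Reasoning

sumFin≡sum : ∀ n (f : Fin n → ℚ) → sumFin n f ≡ sum f
sumFin≡sum zero f = refl
sumFin≡sum (suc n) f = cong (f zero +_) (sumFin≡sum n (f ∘ suc))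

sum-zero : ∀ {n} {f : Fin n → ℚ} → (∀ i → f i ≡ 0ℚ) → sum f ≡ 0ℚ
sum-zero {n} f≗0 = trans (sum-cong-≗ f≗0) (sum-replicate-zero n)

sum-minus-scaled : ∀ {n} (v : ℚ) (f g : Fin n → ℚ) →
  sum (λ i → f i - v * g i) ≡ sum f - v * sum g
sum-minus-scaled v f g = begin
  sum (λ i → f i - v * g i)
    ≡⟨ sum-cong-≗ (λ i → solve 3 (λ v x y → x :- v :* y := x :+ (:- v) :* y) refl v (f i) (g i)) ⟩
  sum (λ i → f i + - v * g i)   ≡⟨ ∑-distrib-+ f (λ i → - v * g i) ⟩
  sum f + sum (λ i → - v * g i) ≡⟨ cong (sum f +_) (sym (*-distribˡ-sum (- v) g)) ⟩
  sum f + - v * sum g           ≡⟨ solve 3 (λ v x y → x :+ (:- v) :* y := x :- v :* y) refl v (sum f) (sum g) ⟩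
  sum f - v * sum g             ∎

-- Power series are coefficient functions: conv is their product, shift w
-- multiplies by tʷ and factor v w multiplies by 1 − v tʷ.
Series : Set
Series = ℕ → ℚ

one : Series
one zero    = 1ℚ
one (suc _) = 0ℚ

shift : ℕ → Series → Series
shift zero    f k       = f k
shift (suc w) f zero    = 0ℚ
shift (suc w) f (suc k) = shift w f k

factor : ℚ → ℕ → Series → Series
factor v w f k = f k - v * shift w f k

conv : Series → Series → Series
conv a b n = sum {suc n} (λ k → a (toℕ k) * b (n ∸ toℕ k))

shift-≥ : ∀ {w k} (f : Series) → w ≤ k → shift w f k ≡ f (k ∸ w)
shift-≥ {zero}          f z≤n       = refl
shift-≥ {suc w} {suc k} f (s≤s w≤k) = shift-≥ f w≤k

shift-< : ∀ {w k} (f : Series) → k < w → shift w f k ≡ 0ℚ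
shift-< {suc w} {zero}  f _         = refl
shift-< {suc w} {suc k} f (s≤s k<w) = shift-< f k<w

shift-cong : ∀ w {f g : Series} → f ≗ g → shift w f ≗ shift w g
shift-cong zero    f≗g k       = f≗g k
shift-cong (suc w) f≗g zero    = refl
shift-cong (suc w) f≗g (suc k) = shift-cong w f≗g k

conv-cong : ∀ {a a' b b' : Series} → a ≗ a' → b ≗ b' → conv a b ≗ conv a' b'
conv-cong a≗a' b≗b' n = sum-cong-≗ {suc n} (λ k → cong₂ _*_ (a≗a' (toℕ k)) (b≗b' (n ∸ toℕ k)))

conv-comm : ∀ (a b : Series) → conv a b ≗ conv b a
conv-comm a b n = trans (sum-permute (λ k → a (toℕ k) * b (n ∸ toℕ k)) Perm.reverse) (sum-cong-≗ reflect)
  where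
  reflect : ∀ (k : Fin (suc n)) → a (toℕ (opposite k)) * b (n ∸ toℕ (opposite k))
                                 ≡ b (toℕ k) * a (n ∸ toℕ k)
  reflect k rewrite Finₚ.opposite-prop k | ℕₚ.m∸[m∸n]≡n (Finₚ.toℕ≤pred[n] k) =
    ℚₚ.*-comm (a (n ∸ toℕ k)) (b (toℕ k))

conv-oneˡ : ∀ b → conv one b ≗ b
conv-oneˡ b zero    = solve 1 (λ x → con 1ℚ :* x :+ con 0ℚ := x) refl (b 0)
conv-oneˡ b (suc n) = begin
  1ℚ * b (suc n) + sum {suc n} (λ k → 0ℚ * b (n ∸ toℕ k))
    ≡⟨ cong (1ℚ * b (suc n) +_) (sum-zero {suc n} (λ k → ℚₚ.*-zeroˡ (b (n ∸ toℕ k)))) ⟩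
  1ℚ * b (suc n) + 0ℚ ≡⟨ solve 1 (λ x → con 1ℚ :* x :+ con 0ℚ := x) refl (b (suc n)) ⟩
  b (suc n)           ∎

conv-shiftˡ : ∀ w (a b : Series) → conv (shift w a) b ≗ shift w (conv a b)
conv-shiftˡ zero    a b n       = refl
conv-shiftˡ (suc w) a b zero    = solve 1 (λ x → con 0ℚ :* x :+ con 0ℚ := con 0ℚ) refl (b 0)
conv-shiftˡ (suc w) a b (suc n) = begin
  0ℚ * b (suc n) + conv (shift w a) b n
    ≡⟨ solve 2 (λ x y → con 0ℚ :* x :+ y := y) refl (b (suc n)) (conv (shift w a) b n) ⟩
  conv (shift w a) b n      ≡⟨ conv-shiftˡ w a b n ⟩
  shift w (conv a b) n      ∎

conv-shift-comm : ∀ w (a b : Series) → conv (shift w a) b ≗ conv a (shift w b)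
conv-shift-comm w a b n = begin
  conv (shift w a) b n ≡⟨ conv-shiftˡ w a b n ⟩
  shift w (conv a b) n ≡⟨ shift-cong w (conv-comm a b) n ⟩
  shift w (conv b a) n ≡⟨ sym (conv-shiftˡ w b a n) ⟩
  conv (shift w b) a n ≡⟨ conv-comm (shift w b) a n ⟩
  conv a (shift w b) n ∎

conv-factorˡ : ∀ v w (a b : Series) n →
  conv (factor v w a) b n ≡ conv a b n - v * conv (shift w a) b n
conv-factorˡ v w a b n = trans
  (sum-cong-≗ {suc n} λ k → solve 4 (λ v x y z → (x :- v :* y) :* z := x :* z :- v :* (y :* z))
                      refl v (a (toℕ k)) (shift w a (toℕ k)) (b (n ∸ toℕ k)))
  (sum-minus-scaled {suc n} v (λ k → a (toℕ k) * b (n ∸ toℕ k)) (λ k → shift w a (toℕ k) * b (n ∸ toℕ k)))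

conv-factorʳ : ∀ v w (a b : Series) n →
  conv a (factor v w b) n ≡ conv a b n - v * conv a (shift w b) n
conv-factorʳ v w a b n = trans
  (sum-cong-≗ {suc n} λ k → solve 4 (λ v x y z → x :* (y :- v :* z) := x :* y :- v :* (x :* z))
                      refl v (a (toℕ k)) (b (n ∸ toℕ k)) (shift w b (n ∸ toℕ k)))
  (sum-minus-scaled {suc n} v (λ k → a (toℕ k) * b (n ∸ toℕ k)) (λ k → a (toℕ k) * shift w b (n ∸ toℕ k)))

conv-factor : ∀ v w (a b : Series) → conv (factor v w a) b ≗ conv a (factor v w b)
conv-factor v w a b n = begin
  conv (factor v w a) b n                  ≡⟨ conv-factorˡ v w a b n ⟩
  conv a b n - v * conv (shift w a) b n    ≡⟨ cong (λ z → conv a b n - v * z) (conv-shift-comm w a b n) ⟩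
  conv a b n - v * conv a (shift w b) n    ≡⟨ sym (conv-factorʳ v w a b n) ⟩
  conv a (factor v w b) n                  ∎

PositiveWeights : Vars → Set
PositiveWeights = All ((1 ≤_) ∘ proj₁)

vars-positiveWeights : ∀ K N m x → PositiveWeights (vars K N m x)
vars-positiveWeights K N m x = Allₚ.concat⁺ (Allₚ.map⁺ (universal
  (λ _ → Allₚ.map⁺ (universal (λ _ → s≤s z≤n) (allFin N))) (allFin K)))

Hev-zero : ∀ vs → Hev vs 0 ≡ 1ℚ
Hev-zero []             = refl
Hev-zero ((w , v) ∷ vs) = Hev-zero vs

Eev-zero : ∀ {vs} → PositiveWeights vs → Eev vs 0 ≡ 1ℚ
Eev-zero []             = refl
Eev-zero (s≤s z≤n ∷ ws) = Eev-zero ws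

Eev-∷ : ∀ w v vs → Eev ((w , v) ∷ vs) ≗ factor v w (Eev vs)
Eev-∷ w v vs k with w ≤? k
... | yes w≤k = cong (λ z → Eev vs k - v * z) (sym (shift-≥ (Eev vs) w≤k))
... | no  w≰k = begin
  Eev vs k                             ≡⟨ solve 2 (λ v x → x := x :- v :* con 0ℚ) refl v (Eev vs k) ⟩
  Eev vs k - v * 0ℚ                    ≡⟨ cong (λ z → Eev vs k - v * z) (sym (shift-< (Eev vs) (ℕₚ.≰⇒> w≰k))) ⟩
  Eev vs k - v * shift w (Eev vs) k    ∎

module _ (v : ℚ) (w : ℕ) (h : Series) where

  Hsum-suc-≤ : ∀ {d} k → w ℕ.* suc k ≤ d →
    Hsum v w h d (suc k) ≡ Hsum v w h d k + (v ^ℚ suc k) * h (d ∸ w ℕ.* suc k)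
  Hsum-suc-≤ {d} k p with w ℕ.* suc k ≤? d
  ... | yes _ = refl
  ... | no ¬p = contradiction p ¬p

  Hsum-suc-≰ : ∀ {d} k → ¬ (w ℕ.* suc k ≤ d) → Hsum v w h d (suc k) ≡ Hsum v w h d k
  Hsum-suc-≰ {d} k ¬p with w ℕ.* suc k ≤? d
  ... | yes p = contradiction p ¬p
  ... | no _  = refl

  Hsum-below : ∀ {d} → d < w → ∀ k → Hsum v w h d k ≡ h d
  Hsum-below d<w zero    = refl
  Hsum-below d<w (suc k) = trans
    (Hsum-suc-≰ k (ℕₚ.<⇒≱ (ℕₚ.<-≤-trans d<w (ℕₚ.m≤m*n w (suc k)))))
    (Hsum-below d<w k)

  Hsum-stable : ∀ {d k} → 1 ≤ w → d ≤′ k → Hsum v w h d k ≡ Hsum v w h d d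
  Hsum-stable 1≤w ≤′-refl           = refl
  Hsum-stable 1≤w (≤′-step {k} d≤k) = trans
    (Hsum-suc-≰ k (ℕₚ.<⇒≱ (ℕₚ.<-≤-trans (s≤s (ℕₚ.≤′⇒≤ d≤k)) (ℕₚ.m≤n*m (suc k) w {{ℕ.>-nonZero 1≤w}}))))
    (Hsum-stable 1≤w d≤k)

  Hsum-peel : ∀ {d} → w ≤ d → ∀ k → Hsum v w h d (suc k) ≡ h d + v * Hsum v w h (d ∸ w) k
  Hsum-peel {d} w≤d zero = begin
    Hsum v w h d 1                      ≡⟨ Hsum-suc-≤ 0 (subst (_≤ d) (sym w*1≡w) w≤d) ⟩
    h d + (v * 1ℚ) * h (d ∸ w ℕ.* 1)    ≡⟨ cong (λ e → h d + (v * 1ℚ) * h (d ∸ e)) w*1≡w ⟩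
    h d + (v * 1ℚ) * h (d ∸ w)
      ≡⟨ solve 3 (λ x v y → x :+ (v :* con 1ℚ) :* y := x :+ v :* y) refl (h d) v (h (d ∸ w)) ⟩
    h d + v * h (d ∸ w)                 ∎
    where w*1≡w = ℕₚ.*-identityʳ w
  Hsum-peel {d} w≤d (suc k) with w ℕ.* suc (suc k) ≤? d
  ... | yes p = begin
    Hsum v w h d (suc k) + (v * (v ^ℚ suc k)) * h (d ∸ w ℕ.* suc (suc k))
      ≡⟨ cong₂ (λ x e → x + (v * (v ^ℚ suc k)) * h e) (Hsum-peel w≤d k) index ⟩
    (h d + v * Hsum v w h (d ∸ w) k) + (v * (v ^ℚ suc k)) * h (d ∸ w ∸ w ℕ.* suc k)
      ≡⟨ solve 5 (λ x v y u z → (x :+ v :* y) :+ (v :* u) :* z := x :+ v :* (y :+ u :* z))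
           refl (h d) v (Hsum v w h (d ∸ w) k) (v ^ℚ suc k) (h (d ∸ w ∸ w ℕ.* suc k)) ⟩
    h d + v * (Hsum v w h (d ∸ w) k + (v ^ℚ suc k) * h (d ∸ w ∸ w ℕ.* suc k))
      ≡⟨ cong (λ z → h d + v * z) (sym (Hsum-suc-≤ k (bound⇒ p))) ⟩
    h d + v * Hsum v w h (d ∸ w) (suc k) ∎
    where
    index : d ∸ w ℕ.* suc (suc k) ≡ d ∸ w ∸ w ℕ.* suc k
    index = trans (cong (d ∸_) (ℕₚ.*-suc w (suc k))) (sym (ℕₚ.∸-+-assoc d w (w ℕ.* suc k)))
    bound⇒ : w ℕ.* suc (suc k) ≤ d → w ℕ.* suc k ≤ d ∸ w
    bound⇒ p = ℕₚ.m+n≤o⇒m≤o∸n (w ℕ.* suc k)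
      (subst (_≤ d) (trans (ℕₚ.*-suc w (suc k)) (ℕₚ.+-comm w _)) p)
  ... | no ¬p = trans (Hsum-peel w≤d k) (cong (λ z → h d + v * z) (sym (Hsum-suc-≰ k (¬p ∘ ⇐bound))))
    where
    ⇐bound : w ℕ.* suc k ≤ d ∸ w → w ℕ.* suc (suc k) ≤ d
    ⇐bound q = subst (_≤ d) (trans (ℕₚ.+-comm _ w) (sym (ℕₚ.*-suc w (suc k))))
      (ℕₚ.m≤o∸n⇒m+n≤o (w ℕ.* suc k) w≤d q)

Hev-∷-peel : ∀ {w k} v vs → 1 ≤ w → w ≤ k →
  Hev ((w , v) ∷ vs) k ≡ Hev vs k + v * Hev ((w , v) ∷ vs) (k ∸ w)
Hev-∷-peel {k = zero}  v vs 1≤w z≤n = contradiction 1≤w λ ()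
Hev-∷-peel {w} {suc k} v vs 1≤w w≤k = begin
  Hsum v w (Hev vs) (suc k) (suc k)             ≡⟨ Hsum-peel v w (Hev vs) w≤k k ⟩
  Hev vs (suc k) + v * Hsum v w (Hev vs) (suc k ∸ w) k
    ≡⟨ cong (λ z → Hev vs (suc k) + v * z)
         (Hsum-stable v w (Hev vs) 1≤w (ℕₚ.≤⇒≤′ (ℕₚ.∸-monoʳ-≤ (suc k) 1≤w))) ⟩
  Hev vs (suc k) + v * Hev ((w , v) ∷ vs) (suc k ∸ w) ∎

Hev-∷ : ∀ {w} v vs → 1 ≤ w → factor v w (Hev ((w , v) ∷ vs)) ≗ Hev vs
Hev-∷ {w} v vs 1≤w k with w ≤? k
... | yes w≤k = begin
  H k - v * shift w H k                   ≡⟨ cong (λ z → H k - v * z) (shift-≥ H w≤k) ⟩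
  H k - v * H (k ∸ w)                     ≡⟨ cong (_- v * H (k ∸ w)) (Hev-∷-peel v vs 1≤w w≤k) ⟩
  (Hev vs k + v * H (k ∸ w)) - v * H (k ∸ w)
    ≡⟨ solve 3 (λ x v y → (x :+ v :* y) :- v :* y := x) refl (Hev vs k) v (H (k ∸ w)) ⟩
  Hev vs k                                ∎
  where H = Hev ((w , v) ∷ vs)
... | no w≰k = begin
  H k - v * shift w H k   ≡⟨ cong₂ (λ x y → x - v * y) (Hsum-below v w (Hev vs) k<w k) (shift-< H k<w) ⟩
  Hev vs k - v * 0ℚ       ≡⟨ solve 2 (λ x v → x :- v :* con 0ℚ := x) refl (Hev vs k) v ⟩
  Hev vs k                ∎
  where
  H = Hev ((w , v) ∷ vs)
  k<w = ℕₚ.≰⇒> w≰k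

conv-Eev-Hev : ∀ {vs} → PositiveWeights vs → conv (Eev vs) (Hev vs) ≗ one
conv-Eev-Hev {[]} [] n = begin
  conv (Eev []) (Hev []) n ≡⟨ conv-cong {b = Hev []} Eev-[] (λ _ → refl) n ⟩
  conv one (Hev []) n      ≡⟨ conv-oneˡ (Hev []) n ⟩
  Hev [] n                 ≡⟨ Hev-[] n ⟩
  one n                    ∎
  where
  Eev-[] : Eev [] ≗ one
  Eev-[] zero    = refl
  Eev-[] (suc _) = refl
  Hev-[] : Hev [] ≗ one
  Hev-[] zero    = refl
  Hev-[] (suc _) = refl
conv-Eev-Hev {(w , v) ∷ vs} (1≤w ∷ ws) n = begin
  conv E H n                     ≡⟨ conv-cong {b = H} (Eev-∷ w v vs) (λ _ → refl) n ⟩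
  conv (factor v w (Eev vs)) H n ≡⟨ conv-factor v w (Eev vs) H n ⟩
  conv (Eev vs) (factor v w H) n ≡⟨ conv-cong {a = Eev vs} (λ _ → refl) (Hev-∷ v vs 1≤w) n ⟩
  conv (Eev vs) (Hev vs) n       ≡⟨ conv-Eev-Hev ws n ⟩
  one n                          ∎
  where
  E = Eev ((w , v) ∷ vs)
  H = Hev ((w , v) ∷ vs)

sgn-+ : ∀ a b → sgn (a ℕ.+ b) ≡ sgn a * sgn b
sgn-+ zero    b = sym (ℚₚ.*-identityˡ (sgn b))
sgn-+ (suc a) b = trans (cong -_ (sgn-+ a b)) (solve 2 (λ x y → :- (x :* y) := (:- x) :* y) refl (sgn a) (sgn b))

sgn*sgn≡1 : ∀ a → sgn a * sgn a ≡ 1ℚ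
sgn*sgn≡1 zero    = refl
sgn*sgn≡1 (suc a) = trans (solve 1 (λ x → (:- x) :* (:- x) := x :* x) refl (sgn a)) (sgn*sgn≡1 a)

det-cong : ∀ n {A B : Fin n → Fin n → ℚ} → (∀ i j → A i j ≡ B i j) → det n A ≡ det n B
det-cong zero    A≡B = refl
det-cong (suc n) A≡B = sumFin-cong (suc n) λ j →
  cong₂ (λ x y → sgn (toℕ j) * (x * y)) (A≡B zero j) (det-cong n (λ r c → A≡B (suc r) (punchIn j c)))
  where
  sumFin-cong : ∀ n {f g : Fin n → ℚ} → (∀ j → f j ≡ g j) → sumFin n f ≡ sumFin n g
  sumFin-cong n {f} {g} f≡g = trans (sumFin≡sum n f) (trans (sum-cong-≗ f≡g) (sym (sumFin≡sum n g)))

det-zeroColumn : ∀ n (A : Fin (suc n) → Fin (suc n) → ℚ) → (∀ i → A i zero ≡ 0ℚ) → det (suc n) A ≡ 0ℚ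
det-firstColumn : ∀ n (A : Fin (suc n) → Fin (suc n) → ℚ) → (∀ r → A (suc r) zero ≡ 0ℚ) →
  det (suc n) A ≡ A zero zero * det n (λ r c → A (suc r) (suc c))
det-laterTerms : ∀ n (A : Fin (suc n) → Fin (suc n) → ℚ) → (∀ r → A (suc r) zero ≡ 0ℚ) →
  sumFin n (λ j → sgn (toℕ (suc j)) * (A zero (suc j) * det n (λ r c → A (suc r) (punchIn (suc j) c)))) ≡ 0ℚ

det-zeroColumn n A A·0≡0 = begin
  det (suc n) A                                     ≡⟨ det-firstColumn n A (A·0≡0 ∘ suc) ⟩
  A zero zero * det n (λ r c → A (suc r) (suc c))   ≡⟨ cong (_* det n (λ r c → A (suc r) (suc c))) (A·0≡0 zero) ⟩
  0ℚ * det n (λ r c → A (suc r) (suc c))            ≡⟨ ℚₚ.*-zeroˡ (det n (λ r c → A (suc r) (suc c))) ⟩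
  0ℚ                                                ∎

det-firstColumn n A A·0≡0 = trans (cong (1ℚ * (A zero zero * M) +_) (det-laterTerms n A A·0≡0))
  (solve 1 (λ x → con 1ℚ :* x :+ con 0ℚ := x) refl (A zero zero * M))
  where M = det n (λ r c → A (suc r) (suc c))

det-laterTerms zero    A A·0≡0 = refl
det-laterTerms (suc n) A A·0≡0 = trans (sumFin≡sum (suc n) term) (sum-zero term≡0)
  where
  term : Fin (suc n) → ℚ
  term j = sgn (toℕ (suc j)) * (A zero (suc j) * det (suc n) (λ r c → A (suc r) (punchIn (suc j) c)))
  term≡0 : ∀ j → term j ≡ 0ℚ
  term≡0 j = trans (cong (λ z → sgn (toℕ (suc j)) * (A zero (suc j) * z))
                         (det-zeroColumn n (λ r c → A (suc r) (punchIn (suc j) c)) A·0≡0))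
    (solve 2 (λ s a → s :* (a :* con 0ℚ) := con 0ℚ) refl (sgn (toℕ (suc j))) (A zero (suc j)))

toeplitzDet : (ℤ → ℚ) → ℕ → ℚ
toeplitzDet F n = det n (λ i j → F (idx i j))

idx-suc : ∀ {d} (i j : Fin d) → idx (suc i) (suc j) ≡ idx i j
idx-suc i j = cancel-one (ℤ.+ toℕ i) (ℤ.+ toℕ j)
  where
  cancel-one : ∀ a b → (ℤ.+ 1 ℤ.- (ℤ.+ 1 ℤ.+ a)) ℤ.+ (ℤ.+ 1 ℤ.+ b) ≡ (ℤ.+ 1 ℤ.- a) ℤ.+ b
  cancel-one = solve-∀

module _ (F : ℤ → ℚ) (F-neg : ∀ n → F -[1+ n ] ≡ 0ℚ) (F-zero : F (ℤ.+ 0) ≡ 1ℚ) where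

  -- The minor is block lower triangular: a unitriangular block of size toℕ j,
  -- then the Toeplitz matrix of size n ∸ toℕ j.
  toeplitz-minor : ∀ n (j : Fin (suc n)) →
    det n (λ r c → F (idx (suc r) (punchIn j c))) ≡ toeplitzDet F (n ∸ toℕ j)
  toeplitz-minor n       zero    = det-cong n (λ r c → cong F (idx-suc r c))
  toeplitz-minor (suc n) (suc j) = begin
    det (suc n) (λ r c → F (idx (suc r) (punchIn (suc j) c)))
      ≡⟨ det-firstColumn n (λ r c → F (idx (suc r) (punchIn (suc j) c))) (λ r → F-neg (toℕ r)) ⟩
    F (ℤ.+ 0) * det n (λ r c → F (idx (suc (suc r)) (suc (punchIn j c))))
      ≡⟨ cong₂ _*_ F-zero (det-cong n (λ r c → cong F (idx-suc (suc r) (punchIn j c)))) ⟩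
    1ℚ * det n (λ r c → F (idx (suc r) (punchIn j c)))
      ≡⟨ ℚₚ.*-identityˡ (det n (λ r c → F (idx (suc r) (punchIn j c)))) ⟩
    det n (λ r c → F (idx (suc r) (punchIn j c)))
      ≡⟨ toeplitz-minor n j ⟩
    toeplitzDet F (n ∸ toℕ j) ∎

  toeplitz-expand : ∀ n → toeplitzDet F (suc n) ≡
    sum {suc n} (λ j → sgn (toℕ j) * (F (ℤ.+ suc (toℕ j)) * toeplitzDet F (n ∸ toℕ j)))
  toeplitz-expand n = trans (sumFin≡sum (suc n) expansion) (sum-cong-≗ λ j →
    cong (λ z → sgn (toℕ j) * (F (idx zero j) * z)) (toeplitz-minor n j))
    where
    expansion : Fin (suc n) → ℚ
    expansion j = sgn (toℕ j) * (F (idx zero j) * det n (λ r c → F (idx (suc r) (punchIn j c))))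

  module _ (b : Series) (b-inverse : conv (F ∘ ℤ.+_) b ≗ one) where

    b-zero : b 0 ≡ 1ℚ
    b-zero = begin
      b 0                       ≡⟨ solve 1 (λ x → x := con 1ℚ :* x :+ con 0ℚ) refl (b 0) ⟩
      1ℚ * b 0 + 0ℚ             ≡⟨ cong (λ z → z * b 0 + 0ℚ) (sym F-zero) ⟩
      F (ℤ.+ 0) * b 0 + 0ℚ      ≡⟨ b-inverse 0 ⟩
      1ℚ                        ∎

    conv-tail : ∀ n → sum {suc n} (λ j → F (ℤ.+ suc (toℕ j)) * b (n ∸ toℕ j)) ≡ - b (suc n)
    conv-tail n = begin
      S                          ≡⟨ inverseʳ-unique (F (ℤ.+ 0) * b (suc n)) S (b-inverse (suc n)) ⟩
      - (F (ℤ.+ 0) * b (suc n))  ≡⟨ cong (λ z → - (z * b (suc n))) F-zero ⟩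
      - (1ℚ * b (suc n))         ≡⟨ cong -_ (ℚₚ.*-identityˡ (b (suc n))) ⟩
      - b (suc n)                ∎
      where S = sum {suc n} (λ j → F (ℤ.+ suc (toℕ j)) * b (n ∸ toℕ j))

    toeplitzDet≡sgn*inverse : ∀ d → toeplitzDet F d ≡ sgn d * b d
    toeplitzDet≡sgn*inverse = <-rec (λ d → toeplitzDet F d ≡ sgn d * b d) step
      where
      step : ∀ d → (∀ {k} → k < d → toeplitzDet F k ≡ sgn k * b k) → toeplitzDet F d ≡ sgn d * b d
      step zero    _  = sym (trans (ℚₚ.*-identityˡ (b 0)) b-zero)
      step (suc n) IH = begin
        toeplitzDet F (suc n)
          ≡⟨ toeplitz-expand n ⟩
        sum {suc n} (λ j → sgn (toℕ j) * (F (ℤ.+ suc (toℕ j)) * toeplitzDet F (n ∸ toℕ j)))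
          ≡⟨ sum-cong-≗ term ⟩
        sum {suc n} (λ j → sgn n * (F (ℤ.+ suc (toℕ j)) * b (n ∸ toℕ j)))
          ≡⟨ sym (*-distribˡ-sum {suc n} (sgn n) (λ j → F (ℤ.+ suc (toℕ j)) * b (n ∸ toℕ j))) ⟩
        sgn n * sum {suc n} (λ j → F (ℤ.+ suc (toℕ j)) * b (n ∸ toℕ j))
          ≡⟨ cong (sgn n *_) (conv-tail n) ⟩
        sgn n * - b (suc n)
          ≡⟨ solve 2 (λ s x → s :* (:- x) := (:- s) :* x) refl (sgn n) (b (suc n)) ⟩
        sgn (suc n) * b (suc n) ∎
        where
        term : ∀ (j : Fin (suc n)) → sgn (toℕ j) * (F (ℤ.+ suc (toℕ j)) * toeplitzDet F (n ∸ toℕ j))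
                                  ≡ sgn n * (F (ℤ.+ suc (toℕ j)) * b (n ∸ toℕ j))
        term j = begin
          sgn i * (f * toeplitzDet F (n ∸ i))    ≡⟨ cong (λ z → sgn i * (f * z)) (IH (s≤s (ℕₚ.m∸n≤m n i))) ⟩
          sgn i * (f * (sgn (n ∸ i) * b (n ∸ i)))
            ≡⟨ solve 4 (λ s f t x → s :* (f :* (t :* x)) := (s :* t) :* (f :* x)) refl (sgn i) f (sgn (n ∸ i)) (b (n ∸ i)) ⟩
          (sgn i * sgn (n ∸ i)) * (f * b (n ∸ i))
            ≡⟨ cong (_* (f * b (n ∸ i))) (trans (sym (sgn-+ i (n ∸ i))) (cong sgn (ℕₚ.m+[n∸m]≡n (Finₚ.toℕ≤pred[n] j)))) ⟩
          sgn n * (f * b (n ∸ i))                ∎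
          where
          i = toℕ j
          f = F (ℤ.+ suc i)

    inverse≡sgn*toeplitzDet : ∀ d → b d ≡ sgn d * toeplitzDet F d
    inverse≡sgn*toeplitzDet d = begin
      b d                          ≡⟨ sym (ℚₚ.*-identityˡ (b d)) ⟩
      1ℚ * b d                     ≡⟨ cong (_* b d) (sym (sgn*sgn≡1 d)) ⟩
      (sgn d * sgn d) * b d        ≡⟨ ℚₚ.*-assoc (sgn d) (sgn d) (b d) ⟩
      sgn d * (sgn d * b d)        ≡⟨ cong (sgn d *_) (sym (toeplitzDet≡sgn*inverse d)) ⟩
      sgn d * toeplitzDet F d      ∎

mainTheorem1 : (d m : ℕ) → 1 ≤ d → 1 ≤ m →
    (K N : ℕ) (x : Fin K → Fin N → ℚ) →
    (Eev (vars K N m x) d ≡ sgn d * det d (λ i j → HZ K N m x (idx i j)))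
    × (Hev (vars K N m x) d ≡ sgn d * det d (λ i j → EZ K N m x (idx i j)))
mainTheorem1 d m _ _ K N x =
    inverse≡sgn*toeplitzDet (HZ K N m x) (λ _ → refl) (Hev-zero V) (Eev V) H*E≗one d
  , inverse≡sgn*toeplitzDet (EZ K N m x) (λ _ → refl) (Eev-zero W) (Hev V) (conv-Eev-Hev W) d
  where
  V = vars K N m x
  W = vars-positiveWeights K N m x
  H*E≗one : conv (Hev V) (Eev V) ≗ one
  H*E≗one n = trans (conv-comm (Hev V) (Eev V) n) (conv-Eev-Hev W n)
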